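{- Let $G$ be a group with identity $\mathbf{1}$, $S$ an inverse-closed subset of $G$, and suppose $X=\mathrm{Cay}(G;S)$ is connected. Let $\mathcal{A}^0_{\mathbf{1}}(X)$ be the group of colour-preserving automorphisms of $X$ fixing the vertex $\mathbf{1}$ (which acts on $S$, the neighbourhood of $\mathbf{1}$). If the action of $\mathcal{A}^0_{\mathbf{1}}(X)$ on $S$ is semiregular, then $X$ is strongly CCA.
   Context: $\mathrm{Cay}(G;S)$ has vertex set $G$ and edges $\{g,gs\}$ for $g\in G$, $s\in S$; the edge $\{g,gs\}$ is coloured $\{s,s^{ -1}\}$. A graph automorphism is colour-preserving if it maps each edge to an edge of the same colour, and colour-permuting if any two edges of the same colour are mapped to edges of a common colour. A permutation group is semiregular if no nonidentity element has a fixed point. A map $G\to G$ is affine if it is of the form $x\mapsto\alpha(gx)$ with $\alpha$ a group automorphism of $G$ and $g\in G$; $X$ is strongly CCA if every colour-permuting automorphism of $X$ is affine. -}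

module Defs where

open import Level using (Level; _⊔_; suc)
open import Data.Product using (Σ; ∃; _×_; _,_)
open import Data.Sum using (_⊎_)
open import Relation.Binary.PropositionalEquality using (_≡_)
open import Relation.Unary using (Pred)
open import Algebra.Core using (Op₁; Op₂)
open import Algebra.Structures using (IsGroup)

record PGroup (a : Level) : Set (suc a) where
  infixl 7 _∙_
  field
    Carrier : Set a
    _∙_     : Op₂ Carrier
    ε       : Carrier
    _⁻¹     : Op₁ Carrier
    isGroup : IsGroup _≡_ _∙_ ε _⁻¹

module Cayley {a ℓ : Level} (G : PGroup a) (S : Pred (PGroup.Carrier G) ℓ) where
  open PGroup G

  InverseClosed : Set (a ⊔ ℓ)
  InverseClosed = ∀ s → S s → S (s ⁻¹)

  Adj : Carrier → Carrier → Set (a ⊔ ℓ)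
  Adj x y = Σ Carrier λ s → S s × (y ≡ x ∙ s)

  data Reachable : Carrier → Set (a ⊔ ℓ) where
    base : Reachable ε
    step : ∀ {x y} → Reachable x → Adj x y → Reachable y

  Connected : Set (a ⊔ ℓ)
  Connected = ∀ x → Reachable x

  -- the edge {x,y} (with y = x s) has colour {s, s⁻¹}, where s = x⁻¹ y.
  -- HasColour x y c : the edge {x,y} has colour {c, c⁻¹}
  HasColour : Carrier → Carrier → Carrier → Set a
  HasColour x y c = ((x ⁻¹) ∙ y ≡ c) ⊎ ((x ⁻¹) ∙ y ≡ c ⁻¹)

  SameColour : Carrier → Carrier → Carrier → Carrier → Set a
  SameColour x y u v = HasColour x y ((u ⁻¹) ∙ v)

  record Automorphism : Set (a ⊔ ℓ) where
    field
      fun      : Carrier → Carrier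
      inv      : Carrier → Carrier
      inv-left  : ∀ x → inv (fun x) ≡ x
      inv-right : ∀ x → fun (inv x) ≡ x
      adj-pres  : ∀ x y → Adj x y → Adj (fun x) (fun y)
      adj-refl  : ∀ x y → Adj (fun x) (fun y) → Adj x y

  open Automorphism public

  ColourPreserving : Automorphism → Set (a ⊔ ℓ)
  ColourPreserving φ = ∀ x y → Adj x y → SameColour (fun φ x) (fun φ y) x y

  ColourPermuting : Automorphism → Set (a ⊔ ℓ)
  ColourPermuting φ = ∀ x y u v → Adj x y → Adj u v → SameColour x y u v →
                      SameColour (fun φ x) (fun φ y) (fun φ u) (fun φ v)

  InA01 : Automorphism → Set (a ⊔ ℓ)
  InA01 φ = ColourPreserving φ × (fun φ ε ≡ ε)

  -- the permutation group induced by A⁰₁(X) on S (the neighbourhood of 1) is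
  -- semiregular: an element fixing some point of S acts trivially on S
  A01SemiregularOnS : Set (a ⊔ ℓ)
  A01SemiregularOnS = ∀ (φ : Automorphism) → InA01 φ →
                      ∀ s → S s → fun φ s ≡ s → ∀ t → S t → fun φ t ≡ t

  record GroupAut : Set a where
    field
      map     : Carrier → Carrier
      unmap   : Carrier → Carrier
      left    : ∀ x → unmap (map x) ≡ x
      right   : ∀ x → map (unmap x) ≡ x
      hom     : ∀ x y → map (x ∙ y) ≡ map x ∙ map y

  Affine : (Carrier → Carrier) → Set a
  Affine f = Σ GroupAut λ α → Σ Carrier λ g → ∀ x → f x ≡ GroupAut.map α (g ∙ x)

  StronglyCCA : Set (a ⊔ ℓ)
  StronglyCCA = ∀ (φ : Automorphism) → ColourPermuting φ → Affine (fun φ)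

-- Translating a colour-permuting automorphism φ by φ(1)⁻¹ we may assume φ(1) = 1, and must
-- show that φ(g w) = φ(g) φ(w). For fixed g the map ρ_g = L_{φ(g)⁻¹} ∘ φ ∘ L_g ∘ φ⁻¹ fixes 1
-- and is colour-preserving, and it is the identity exactly when that identity holds for g.
-- By semiregularity, a member of A⁰₁(X) fixing one neighbour of 1 fixes every neighbour of 1,
-- hence (conjugating by translations and walking through the connected graph) every vertex.
-- So it suffices to propagate the identity along an edge from g to g s: if it holds at g,
-- then ρ_{g s} fixes s (if φ(s) = φ(s⁻¹), so s = s⁻¹) or fixes φ(s⁻¹) (if φ(s) = φ(s⁻¹)⁻¹),
-- these being the two possibilities allowed by the common colour of the edges {1,s} and {1,s⁻¹}.
module Submission where

open import Defs
open import Level using (Level; _⊔_)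
open import Relation.Unary using (Pred)
open import Data.Product using (Σ; _×_; _,_; proj₁; proj₂)
open import Data.Sum using (_⊎_; inj₁; inj₂)
open import Relation.Binary.PropositionalEquality
open import Algebra.Bundles using (Group)
open import Algebra.Structures using (IsGroup)
import Algebra.Properties.Group as GroupProperties

module _ {a ℓ : Level} (G : PGroup a) (S : Pred (PGroup.Carrier G) ℓ) where
  open PGroup G
  open Cayley G S
  open IsGroup isGroup using (_\\_; assoc; identityˡ; identityʳ; inverseˡ)

  group : Group a a
  group = record { isGroup = isGroup }

  open GroupProperties group
    using (ε⁻¹≈ε; ⁻¹-involutive; ⁻¹-anti-homo-∙; ⁻¹-anti-homo-\\;
           \\-leftDividesˡ; \\-leftDividesʳ; //-rightDividesʳ; ∙-cancelˡ)
  open ≡-Reasoning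

  ε\\x≡x : ∀ x → ε \\ x ≡ x
  ε\\x≡x x = trans (cong (_∙ x) ε⁻¹≈ε) (identityˡ x)

  \\-translation-invariant : ∀ h x y → (h ∙ x) \\ (h ∙ y) ≡ x \\ y
  \\-translation-invariant h x y = begin
    (h ∙ x) ⁻¹ ∙ (h ∙ y)       ≡⟨ cong (_∙ (h ∙ y)) (⁻¹-anti-homo-∙ h x) ⟩
    x ⁻¹ ∙ h ⁻¹ ∙ (h ∙ y)      ≡⟨ assoc (x ⁻¹) (h ⁻¹) (h ∙ y) ⟩
    x ⁻¹ ∙ (h ⁻¹ ∙ (h ∙ y))    ≡⟨ cong (x ⁻¹ ∙_) (\\-leftDividesʳ h y) ⟩
    x ⁻¹ ∙ y                   ∎

  [x∙y]\\x≡y⁻¹ : ∀ x y → (x ∙ y) \\ x ≡ y ⁻¹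
  [x∙y]\\x≡y⁻¹ x y = trans (sym (⁻¹-anti-homo-\\ x (x ∙ y))) (cong _⁻¹ (\\-leftDividesʳ x y))

  x\\y≡z⇒y≡x∙z : ∀ {x y z} → x \\ y ≡ z → y ≡ x ∙ z
  x\\y≡z⇒y≡x∙z {x} {y} eq = trans (sym (\\-leftDividesˡ x y)) (cong (x ∙_) eq)

  -- `HasColour x y c` unfolds to `x \\ y ≡± c`.
  infix 4 _≡±_
  _≡±_ : Carrier → Carrier → Set a
  c ≡± d = (c ≡ d) ⊎ (c ≡ d ⁻¹)

  translation : Carrier → Automorphism
  translation h = record
    { fun       = h ∙_
    ; inv       = h ⁻¹ ∙_
    ; inv-left  = \\-leftDividesʳ h
    ; inv-right = \\-leftDividesˡ h
    ; adj-pres  = λ { x y (s , Ss , refl) → s , Ss , sym (assoc h x s) }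
    ; adj-refl  = λ { x y (s , Ss , eq) → s , Ss , ∙-cancelˡ h y (x ∙ s) (trans eq (assoc h x s)) }
    }

  infixr 9 _∘ᴬ_
  _∘ᴬ_ : Automorphism → Automorphism → Automorphism
  φ ∘ᴬ ψ = record
    { fun       = λ x → fun φ (fun ψ x)
    ; inv       = λ x → inv ψ (inv φ x)
    ; inv-left  = λ x → trans (cong (inv ψ) (inv-left φ (fun ψ x))) (inv-left ψ x)
    ; inv-right = λ x → trans (cong (fun φ) (inv-right ψ (inv φ x))) (inv-right φ x)
    ; adj-pres  = λ x y xy → adj-pres φ _ _ (adj-pres ψ x y xy)
    ; adj-refl  = λ x y xy → adj-refl ψ x y (adj-refl φ _ _ xy)
    }

  inverseᴬ : Automorphism → Automorphism
  inverseᴬ φ = record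
    { fun       = inv φ
    ; inv       = fun φ
    ; inv-left  = inv-right φ
    ; inv-right = inv-left φ
    ; adj-pres  = λ x y xy →
        adj-refl φ _ _ (subst₂ Adj (sym (inv-right φ x)) (sym (inv-right φ y)) xy)
    ; adj-refl  = λ x y xy → subst₂ Adj (inv-right φ x) (inv-right φ y) (adj-pres φ _ _ xy)
    }

  fun-injective : ∀ φ {x y} → fun φ x ≡ fun φ y → x ≡ y
  fun-injective φ {x} {y} eq = trans (sym (inv-left φ x)) (trans (cong (inv φ) eq) (inv-left φ y))

  S⇒Adj-ε : ∀ {s} → S s → Adj ε s
  S⇒Adj-ε {s} Ss = s , Ss , sym (identityˡ s)

  translation-∘-colourPermuting : ∀ h φ → ColourPermuting φ →
                                  ColourPermuting (translation h ∘ᴬ φ)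
  translation-∘-colourPermuting h φ cp x y u v xy uv same =
    subst₂ _≡±_ (sym (\\-translation-invariant h _ _)) (sym (\\-translation-invariant h _ _))
      (cp x y u v xy uv same)

  colourPermuting-translation-colour : ∀ φ → ColourPermuting φ → ∀ g {x y} → Adj x y →
                                       fun φ (g ∙ x) \\ fun φ (g ∙ y) ≡± fun φ x \\ fun φ y
  colourPermuting-translation-colour φ cp g {x} {y} xy =
    cp (g ∙ x) (g ∙ y) x y (adj-pres (translation g) x y xy) xy
       (inj₁ (\\-translation-invariant g x y))

  InA01⇒neighbour-≡± : ∀ ρ → InA01 ρ → ∀ {s} → S s → fun ρ s ≡± s
  InA01⇒neighbour-≡± ρ (cp , ρε) {s} Ss =
    subst₂ _≡±_ (trans (cong (_\\ fun ρ s) ρε) (ε\\x≡x _)) (ε\\x≡x s) (cp ε s (S⇒Adj-ε Ss))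

  conjugate : Automorphism → Carrier → Automorphism
  conjugate ρ x = translation (x ⁻¹) ∘ᴬ ρ ∘ᴬ translation x

  conjugate-InA01 : ∀ ρ → InA01 ρ → ∀ x → fun ρ x ≡ x → InA01 (conjugate ρ x)
  conjugate-InA01 ρ (cp , _) x ρx = colour , fixes-ε
    where
    colour : ColourPreserving (conjugate ρ x)
    colour y z yz = subst₂ _≡±_ (sym (\\-translation-invariant (x ⁻¹) _ _))
                      (\\-translation-invariant x y z)
                      (cp (x ∙ y) (x ∙ z) (adj-pres (translation x) y z yz))
    fixes-ε : x ⁻¹ ∙ fun ρ (x ∙ ε) ≡ ε
    fixes-ε = begin
      x ⁻¹ ∙ fun ρ (x ∙ ε) ≡⟨ cong (λ w → x ⁻¹ ∙ fun ρ w) (identityʳ x) ⟩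
      x ⁻¹ ∙ fun ρ x       ≡⟨ cong (x ⁻¹ ∙_) ρx ⟩
      x ⁻¹ ∙ x             ≡⟨ inverseˡ x ⟩
      ε                    ∎

  module _ (inverseClosed : InverseClosed) (connected : Connected)
           (semiregular : A01SemiregularOnS) where

    InA01-fixing-S-fixes-neighbourhoods :
      ∀ ρ → InA01 ρ → (∀ t → S t → fun ρ t ≡ t) →
      ∀ {x} → Reachable x → fun ρ x ≡ x × (∀ t → S t → fun ρ (x ∙ t) ≡ x ∙ t)
    InA01-fixing-S-fixes-neighbourhoods ρ inA fixesS base =
      proj₂ inA , λ t St → trans (cong (fun ρ) (identityˡ t)) (trans (fixesS t St) (sym (identityˡ t)))
    InA01-fixing-S-fixes-neighbourhoods ρ inA fixesS (step {x} r (s , Ss , refl)) =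
      ρy , λ t St → x\\y≡z⇒y≡x∙z
        (semiregular (conjugate ρ y) (conjugate-InA01 ρ inA y ρy) (s ⁻¹) (inverseClosed s Ss)
                     conjugate-fixes-s⁻¹ t St)
      where
      y = x ∙ s
      IH = InA01-fixing-S-fixes-neighbourhoods ρ inA fixesS r
      ρy : fun ρ y ≡ y
      ρy = proj₂ IH s Ss
      conjugate-fixes-s⁻¹ : y ⁻¹ ∙ fun ρ (y ∙ s ⁻¹) ≡ s ⁻¹
      conjugate-fixes-s⁻¹ = begin
        y ⁻¹ ∙ fun ρ (y ∙ s ⁻¹) ≡⟨ cong (λ w → y ⁻¹ ∙ fun ρ w) (//-rightDividesʳ s x) ⟩
        y ⁻¹ ∙ fun ρ x          ≡⟨ cong (y ⁻¹ ∙_) (proj₁ IH) ⟩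
        y \\ x                  ≡⟨ [x∙y]\\x≡y⁻¹ x s ⟩
        s ⁻¹                    ∎

    FixesANeighbourOfε : Automorphism → Set (a ⊔ ℓ)
    FixesANeighbourOfε ρ = Σ Carrier λ u → S u × fun ρ u ≡ u

    InA01-fixing-neighbour⇒identity : ∀ ρ → InA01 ρ → FixesANeighbourOfε ρ → ∀ x → fun ρ x ≡ x
    InA01-fixing-neighbour⇒identity ρ inA (u , Su , ρu) x =
      proj₁ (InA01-fixing-S-fixes-neighbourhoods ρ inA (semiregular ρ inA u Su ρu) (connected x))

    module ColourPermutingFixingε (φ : Automorphism) (cp : ColourPermuting φ)
                                  (φε : fun φ ε ≡ ε) where

      S-preserved : ∀ {s} → S s → S (fun φ s)
      S-preserved {s} Ss with adj-pres φ ε s (S⇒Adj-ε Ss)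
      ... | c , Sc , eq = subst S (sym (trans eq (trans (cong (_∙ c) φε) (identityˡ c)))) Sc

      image-of-inverse-≡± : ∀ {s} → S s → fun φ s ≡± fun φ (s ⁻¹)
      image-of-inverse-≡± {s} Ss =
        subst₂ _≡±_ (ε-left (fun φ s)) (ε-left (fun φ (s ⁻¹)))
          (cp ε s ε (s ⁻¹) (S⇒Adj-ε Ss) (S⇒Adj-ε (inverseClosed s Ss)) same)
        where
        ε-left : ∀ x → fun φ ε \\ x ≡ x
        ε-left x = trans (cong (_\\ x) φε) (ε\\x≡x x)
        same : SameColour ε s ε (s ⁻¹)
        same = inj₂ (begin
          ε \\ s          ≡⟨ ε\\x≡x s ⟩
          s               ≡⟨ ⁻¹-involutive s ⟨
          s ⁻¹ ⁻¹         ≡⟨ cong _⁻¹ (ε\\x≡x (s ⁻¹)) ⟨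
          (ε \\ s ⁻¹) ⁻¹  ∎)

      inv-ε : inv φ ε ≡ ε
      inv-ε = trans (cong (inv φ) (sym φε)) (inv-left φ ε)

      Multiplicative : Carrier → Set a
      Multiplicative g = ∀ w → fun φ (g ∙ w) ≡ fun φ g ∙ fun φ w

      ρ : Carrier → Automorphism
      ρ g = translation (fun φ g ⁻¹) ∘ᴬ φ ∘ᴬ translation g ∘ᴬ inverseᴬ φ

      ρ-InA01 : ∀ g → InA01 (ρ g)
      ρ-InA01 g = colour , fixes-ε
        where
        colour : ColourPreserving (ρ g)
        colour x y xy =
          subst₂ _≡±_ (sym (\\-translation-invariant (fun φ g ⁻¹) _ _))
                      (cong₂ _\\_ (inv-right φ x) (inv-right φ y))
            (colourPermuting-translation-colour φ cp g (adj-pres (inverseᴬ φ) x y xy))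
        fixes-ε : fun φ g ⁻¹ ∙ fun φ (g ∙ inv φ ε) ≡ ε
        fixes-ε = begin
          fun φ g ⁻¹ ∙ fun φ (g ∙ inv φ ε) ≡⟨ cong (λ w → fun φ g ⁻¹ ∙ fun φ (g ∙ w)) inv-ε ⟩
          fun φ g ⁻¹ ∙ fun φ (g ∙ ε)       ≡⟨ cong (λ w → fun φ g ⁻¹ ∙ fun φ w) (identityʳ g) ⟩
          fun φ g ⁻¹ ∙ fun φ g             ≡⟨ inverseˡ (fun φ g) ⟩
          ε                                ∎

      ρ-identity⇒multiplicative : ∀ g → (∀ z → fun (ρ g) z ≡ z) → Multiplicative g
      ρ-identity⇒multiplicative g ρg≡id w = x\\y≡z⇒y≡x∙z (begin
        fun φ g \\ fun φ (g ∙ w)               ≡⟨ cong (λ v → fun φ g \\ fun φ (g ∙ v)) (sym (inv-left φ w)) ⟩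
        fun φ g \\ fun φ (g ∙ inv φ (fun φ w)) ≡⟨ ρg≡id (fun φ w) ⟩
        fun φ w                                ∎)

      multiplicative-step : ∀ {g s} → S s → Multiplicative g → Multiplicative (g ∙ s)
      multiplicative-step {g} {s} Ss mult =
        ρ-identity⇒multiplicative (g ∙ s)
          (InA01-fixing-neighbour⇒identity (ρ (g ∙ s)) (ρ-InA01 (g ∙ s)) fixed)
        where
        φgs = fun φ (g ∙ s)
        fixed : FixesANeighbourOfε (ρ (g ∙ s))
        fixed with image-of-inverse-≡± Ss
        ... | inj₁ φs≡φs⁻¹ = s , Ss , ρs≡s (InA01⇒neighbour-≡± (ρ (g ∙ s)) (ρ-InA01 (g ∙ s)) Ss)
          where
          ρs≡s : fun (ρ (g ∙ s)) s ≡± s → fun (ρ (g ∙ s)) s ≡ s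
          ρs≡s (inj₁ eq) = eq
          ρs≡s (inj₂ eq) = trans eq (sym (fun-injective φ φs≡φs⁻¹))
        ... | inj₂ φs≡φs⁻¹⁻¹ = u , S-preserved (inverseClosed s Ss) , (begin
          φgs ⁻¹ ∙ fun φ (g ∙ s ∙ inv φ u) ≡⟨ cong (λ v → φgs ⁻¹ ∙ fun φ (g ∙ s ∙ v)) (inv-left φ (s ⁻¹)) ⟩
          φgs ⁻¹ ∙ fun φ (g ∙ s ∙ s ⁻¹)    ≡⟨ cong (λ v → φgs ⁻¹ ∙ fun φ v) (//-rightDividesʳ s g) ⟩
          φgs \\ fun φ g                   ≡⟨ cong (_\\ fun φ g) (mult s) ⟩
          (fun φ g ∙ fun φ s) \\ fun φ g   ≡⟨ [x∙y]\\x≡y⁻¹ (fun φ g) (fun φ s) ⟩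
          fun φ s ⁻¹                       ≡⟨ cong _⁻¹ φs≡φs⁻¹⁻¹ ⟩
          u ⁻¹ ⁻¹                          ≡⟨ ⁻¹-involutive u ⟩
          u                                ∎)
          where
          u = fun φ (s ⁻¹)

      reachable⇒multiplicative : ∀ {g} → Reachable g → Multiplicative g
      reachable⇒multiplicative base w = begin
        fun φ (ε ∙ w)       ≡⟨ cong (fun φ) (identityˡ w) ⟩
        fun φ w             ≡⟨ sym (identityˡ (fun φ w)) ⟩
        ε ∙ fun φ w         ≡⟨ cong (_∙ fun φ w) (sym φε) ⟩
        fun φ ε ∙ fun φ w   ∎
      reachable⇒multiplicative (step r (s , Ss , refl)) =
        multiplicative-step Ss (reachable⇒multiplicative r)

      asGroupAut : GroupAut
      asGroupAut = record
        { map   = fun φ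
        ; unmap = inv φ
        ; left  = inv-left φ
        ; right = inv-right φ
        ; hom   = λ x → reachable⇒multiplicative (connected x)
        }

    stronglyCCA : StronglyCCA
    stronglyCCA φ cp = asGroupAut , inv φ₀ p , λ x → sym (begin
        fun φ₀ (inv φ₀ p ∙ x)        ≡⟨ GroupAut.hom asGroupAut (inv φ₀ p) x ⟩
        fun φ₀ (inv φ₀ p) ∙ fun φ₀ x ≡⟨ cong (_∙ fun φ₀ x) (inv-right φ₀ p) ⟩
        p ∙ (p ⁻¹ ∙ fun φ x)         ≡⟨ \\-leftDividesˡ p (fun φ x) ⟩
        fun φ x                      ∎)
      where
      p = fun φ ε
      φ₀ = translation (p ⁻¹) ∘ᴬ φ
      open ColourPermutingFixingε φ₀ (translation-∘-colourPermuting (p ⁻¹) φ cp) (inverseˡ p)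
        using (asGroupAut)

corollary4p6 : {a ℓ : Level} (G : PGroup a) (S : Pred (PGroup.Carrier G) ℓ) →
    Cayley.InverseClosed G S → Cayley.Connected G S →
    Cayley.A01SemiregularOnS G S → Cayley.StronglyCCA G S
corollary4p6 G S = stronglyCCA G S
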